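{- The numerical semigroup $\mathbb{N}_0$ is the unique numerical semigroup whose $\nu$ sequence satisfies $\nu_i=i+1$ for all $i\in\mathbb{N}_0$ (i.e. the sequence $1,2,3,4,\dots$).
   Context: A numerical semigroup is a subset $\Lambda\subseteq\mathbb{N}_0$ containing $0$, closed under addition, with finite complement in $\mathbb{N}_0$. Its enumeration is the increasing bijection $\lambda:\mathbb{N}_0\to\Lambda$, $\lambda_i=\lambda(i)$. The $\nu$ sequence is $\nu_i=\#\{j\in\mathbb{N}_0: \lambda_i-\lambda_j\in\Lambda\}$. -}

module Defs where

open import Data.Nat using (ℕ; zero; suc; _+_; _∸_; _≤_; _<_)
open import Data.Bool using (Bool; true; false; if_then_else_)
open import Data.Product using (Σ; _×_; ∃)
open import Relation.Binary.PropositionalEquality using (_≡_)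

Subset : Set
Subset = ℕ → Bool

_∈_ : ℕ → Subset → Set
n ∈ Λ = Λ n ≡ true

record IsNumericalSemigroup (Λ : Subset) : Set where
  field
    has-zero : 0 ∈ Λ
    closed   : ∀ m n → m ∈ Λ → n ∈ Λ → (m + n) ∈ Λ
    cofinite : ∃ λ c → ∀ n → c ≤ n → n ∈ Λ

record IsEnumeration (Λ : Subset) (lam : ℕ → ℕ) : Set where
  field
    increasing : ∀ i j → i < j → lam i < lam j
    into       : ∀ i → lam i ∈ Λ
    onto       : ∀ n → n ∈ Λ → Σ ℕ λ i → lam i ≡ n

count : (ℕ → Bool) → ℕ → ℕ
count p zero    = 0
count p (suc k) = (if p k then 1 else 0) + count p k

-- ν_i = #{ j ∈ ℕ₀ : λ_i - λ_j ∈ Λ }.  Since λ is increasing and Λ ⊆ ℕ₀,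
-- λ_i - λ_j ∈ Λ forces λ_j ≤ λ_i, i.e. j ≤ i; so only j < i+1 are counted.
ν : Subset → (ℕ → ℕ) → ℕ → ℕ
ν Λ lam i = count (λ j → Λ (lam i ∸ lam j)) (suc i)

ℕ₀ : Subset
ℕ₀ _ = true

module Submission where

-- Proof idea.  The first half is immediate: in ℕ₀ every difference λᵢ ∸ λⱼ
-- lies in the semigroup, so νᵢ counts all i+1 candidates j ≤ i.
--
-- For uniqueness, νᵢ = i+1 says that λᵢ ∸ λⱼ ∈ Λ for EVERY j ≤ i.  Taking
-- j = 1 and writing m = λ₁ (the multiplicity, m ≥ 1 because λ₀ < λ₁) gives
-- the key fact "n + m ∈ Λ implies n ∈ Λ": the element n + m ≥ m is some
-- λᵢ with i ≥ 1, and then n = λᵢ ∸ λ₁ ∈ Λ.  Iterating, n + k·m ∈ Λ implies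
-- n ∈ Λ for every k.  Since Λ contains every number from its conductor
-- bound c on, and n + c·m ≥ c, every n lies in Λ.

open import Defs
open import Data.Nat using (ℕ; zero; suc; _+_; _*_; _∸_; _≤_; _<_; z≤n; s≤s; s≤s⁻¹; >-nonZero)
open import Data.Nat.Properties
open import Data.Bool using (true; false)
open import Data.Sum using (inj₁; inj₂)
open import Data.Product using (_×_; _,_)
open import Data.Empty using (⊥-elim)
open import Relation.Binary.PropositionalEquality

count-const-true : ∀ k → count (λ _ → true) k ≡ k
count-const-true zero    = refl
count-const-true (suc k) = cong suc (count-const-true k)

count≤ : ∀ p k → count p k ≤ k
count≤ p zero = z≤n
count≤ p (suc k) with p k
... | true  = s≤s (count≤ p k)
... | false = m≤n⇒m≤1+n (count≤ p k)

count-full⇒all : ∀ p k → count p k ≡ k → ∀ j → j < k → p j ≡ true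
count-full⇒all p (suc k) full j j<1+k with p k in pk
... | false = ⊥-elim (1+n≰n (subst (_≤ k) full (count≤ p k)))
... | true with m≤n⇒m<n∨m≡n (s≤s⁻¹ j<1+k)
...   | inj₁ j<k  = count-full⇒all p k (suc-injective full) j j<k
...   | inj₂ refl = pk

ℕ₀-isNumericalSemigroup : IsNumericalSemigroup ℕ₀
ℕ₀-isNumericalSemigroup = record
  { has-zero = refl
  ; closed   = λ _ _ _ _ → refl
  ; cofinite = 0 , λ _ _ → refl
  }

ν-ℕ₀ : ∀ lam → ∀ i → ν ℕ₀ lam i ≡ suc i
ν-ℕ₀ lam i = count-const-true (suc i)

module Uniqueness (Λ : Subset) (lam : ℕ → ℕ)
                  (S : IsNumericalSemigroup Λ) (E : IsEnumeration Λ lam)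
                  (ν≡suc : ∀ i → ν Λ lam i ≡ suc i) where
  open IsNumericalSemigroup S
  open IsEnumeration E

  differences∈Λ : ∀ i j → j ≤ i → (lam i ∸ lam j) ∈ Λ
  differences∈Λ i j j≤i =
    count-full⇒all (λ j → Λ (lam i ∸ lam j)) (suc i) (ν≡suc i) j (s≤s j≤i)

  m : ℕ
  m = lam 1

  λ₀<m : lam 0 < m
  λ₀<m = increasing 0 1 (s≤s z≤n)

  m-positive : 1 ≤ m
  m-positive = ≤-trans (s≤s z≤n) λ₀<m

  shift-down : ∀ n → (n + m) ∈ Λ → n ∈ Λ
  shift-down n n+m∈Λ with onto (n + m) n+m∈Λ
  ... | zero , λ₀≡n+m =
    ⊥-elim (<⇒≱ λ₀<m (subst (m ≤_) (sym λ₀≡n+m) (m≤n+m m n)))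
  ... | suc i , λᵢ≡n+m =
    subst (_∈ Λ) (trans (cong (_∸ m) λᵢ≡n+m) (m+n∸n≡m n m))
          (differences∈Λ (suc i) 1 (s≤s z≤n))

  shift-down-many : ∀ k n → (n + k * m) ∈ Λ → n ∈ Λ
  shift-down-many zero    n h = subst (_∈ Λ) (+-identityʳ n) h
  shift-down-many (suc k) n h =
    shift-down n (shift-down-many k (n + m) (subst (_∈ Λ) (sym (+-assoc n m (k * m))) h))

  everything∈Λ : ∀ n → n ∈ Λ
  everything∈Λ n with cofinite
  ... | c , above-c∈Λ =
    shift-down-many c n (above-c∈Λ (n + c * m)
      (≤-trans (m≤m*n c m {{>-nonZero m-positive}}) (m≤n+m (c * m) n)))

mainTheorem10 : (IsNumericalSemigroup ℕ₀ × (∀ lam → IsEnumeration ℕ₀ lam → ∀ i → ν ℕ₀ lam i ≡ suc i))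
                × (∀ Λ lam → IsNumericalSemigroup Λ → IsEnumeration Λ lam
                    → (∀ i → ν Λ lam i ≡ suc i) → ∀ n → Λ n ≡ ℕ₀ n)
mainTheorem10 =
  (ℕ₀-isNumericalSemigroup , λ lam _ → ν-ℕ₀ lam) ,
  λ Λ lam S E ν≡suc → Uniqueness.everything∈Λ Λ lam S E ν≡suc
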